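{- Letting $2\mathbb{N}$ denote the set of even positive integers and $\overline{2\mathbb{N}}=\mathbb{N}\setminus 2\mathbb{N}$ the set of odd positive integers, $$0\le \phi(2\mathbb{N},\overline{2\mathbb{N}})\le\frac12 .$$
   Context: Here $\mathbb{N}=\{1,2,3,\dots\}$ and $[n]=\{1,\dots,n\}$. For $D\subseteq\mathbb{N}$, two permutations $\pi,\sigma$ of $[n]$ are called $G(D)$-different if there is a position $i\in[n]$ with $|\pi(i)-\sigma(i)|\in D$. $T(n,D)$ denotes the maximum cardinality of a set of permutations of $[n]$ any two distinct members of which are $G(D)$-different. For $D\subseteq\mathbb{N}$ with complement $\overline D=\mathbb{N}\setminus D$, the split strength is $$\phi(D,\overline D)=\limsup_{n\to\infty}\frac1n\log_2\frac{T(n,D)\,T(n,\overline D)}{n!}.$$ -}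

module Defs where

open import Data.Nat using (ℕ; suc; _*_; ∣_-_∣; _<_)
open import Data.Fin using (Fin; toℕ)
open import Data.Fin.Permutation using (Permutation′; _⟨$⟩ʳ_)
open import Data.Product using (Σ; ∃; ∃-syntax; _×_)
open import Relation.Binary.PropositionalEquality using (_≡_; _≢_)
open import Relation.Nullary using (¬_)

TwoN : ℕ → Set
TwoN d = ∃[ m ] (d ≡ 2 * suc m)

-- complement of 2ℕ in ℕ = {1,2,...}: positive integers that are not even.
CoTwoN : ℕ → Set
CoTwoN d = (0 < d) × ¬ TwoN d

GDifferent : (D : ℕ → Set) {n : ℕ} → Permutation′ n → Permutation′ n → Set
GDifferent D {n} π σ = ∃[ i ] D ∣ toℕ (π ⟨$⟩ʳ i) - toℕ (σ ⟨$⟩ʳ i) ∣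

-- Code n D k : there is a set of k permutations of [n] (indexed by Fin k),
-- any two distinct members of which are G(D)-different.  (Members at
-- distinct indices are G(D)-different, hence distinct, since 0 ∉ D.)
-- Thus  Code n D k  holds  iff  k ≤ T(n,D).
Code : ℕ → (ℕ → Set) → ℕ → Set
Code n D k = Σ (Fin k → Permutation′ n) λ f →
  ∀ a b → a ≢ b → GDifferent D (f a) (f b)

-- Everything rests on the parity vector  i ↦ π(i) mod 2  of a permutation π.
-- Two distinct permutations with the same parity vector differ somewhere by an
-- even amount, and permutations with different parity vectors differ somewhere
-- by an odd amount.  Hence:
--
--  * lower bound:  classifying all n! permutations by their parity vector, a
--    general fibre/transversal lemma yields a largest fibre (a 2ℕ-code) of
--    size a and one representative per fibre (a co-2ℕ-code) of size b with
--    n! ≤ a·b, so T(n,2ℕ) T(n,co-2ℕ) / n! ≥ 1;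
--  * upper bound:  a co-2ℕ-code has pairwise distinct parity vectors, so
--    b ≤ 2ⁿ; composing a 2ℕ-code with the 2^⌊n/2⌋ permutations that swap
--    values 2j ↔ 2j+1 gives pairwise distinct permutations (a swap never moves
--    a value by an even amount), so a·2^⌊n/2⌋ ≤ n!.  Together
--    a·b ≤ n!·2^⌈n/2⌉, which is φ ≤ 1/2 after raising to powers.
module Submission where

open import Defs
open import Data.Nat using (ℕ; zero; suc; _+_; _*_; _^_; _≤_; _<_; _!; ∣_-_∣; ⌊_/2⌋; z≤n; s≤s; _≤?_)
open import Data.Nat.Properties
open import Data.Nat.Solver using (module +-*-Solver)
open import Data.Fin as F using (Fin; toℕ; opposite; combine; remQuot; funToFin; finToFun)
open import Data.Fin.Patterns using (0F; 1F)
open import Data.Fin.Properties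
  using (toℕ-injective; opposite-involutive; injective⇒≤; ¬∀⟶∃¬; punchIn-injective;
         combine-injective; combine-remQuot; finToFun-funToFin; funToFin-finToFin)
  renaming (_≟_ to _≟F_; suc-injective to Fin-suc-injective)
open import Data.Fin.Permutation
  using (Permutation′; _⟨$⟩ʳ_; _⟨$⟩ˡ_; _≈_; _∘ₚ_; id; remove; insert; lift₀; swap;
         inverseʳ; insert-punchIn; punchIn-permute)
open import Data.List using (List; []; _∷_; length; filter; lookup; allFin)
open import Data.List.Properties using (length-filter; length-tabulate)
open import Data.List.Membership.Propositional using (_∈_)
open import Data.List.Membership.Propositional.Properties using (∈-filter⁻; ∈-lookup)
open import Data.List.Relation.Binary.Subset.Propositional using (_⊆_)
open import Data.List.Relation.Unary.Any using (here; there)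
import Data.List.Relation.Unary.All as All
import Data.List.Relation.Unary.All.Properties as AllProperties
open import Data.List.Relation.Unary.AllPairs using (AllPairs; []; _∷_)
open import Data.List.Relation.Unary.Unique.Propositional using (Unique)
import Data.List.Relation.Unary.Unique.Propositional.Properties as Unique
open import Data.Product using (Σ; ∃-syntax; _×_; _,_; proj₁; proj₂)
open import Function using (_∘_)
open import Relation.Binary using (Symmetric; DecidableEquality)
open import Relation.Binary.PropositionalEquality
open import Relation.Nullary using (¬_; Dec; yes; no; ¬?; contradiction)

parity : ℕ → Fin 2
parity zero    = 0F
parity (suc n) = opposite (parity n)

parity-2+ : ∀ n → parity (2 + n) ≡ parity n
parity-2+ n = opposite-involutive (parity n)

parity-suc-injective : ∀ u v → parity (suc u) ≡ parity (suc v) → parity u ≡ parity v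
parity-suc-injective u v e =
  trans (sym (opposite-involutive (parity u)))
        (trans (cong opposite e) (opposite-involutive (parity v)))

parity-double : ∀ m → parity (2 * m) ≡ 0F
parity-double zero    = refl
parity-double (suc m) = begin
  parity (2 * suc m)                       ≡⟨ cong parity (*-suc 2 m) ⟩
  parity (2 + 2 * m)                       ≡⟨ parity-2+ (2 * m) ⟩
  parity (2 * m)                           ≡⟨ parity-double m ⟩
  0F                                       ∎
  where open ≡-Reasoning

parity-even : ∀ d → parity d ≡ 0F → ∃[ m ] d ≡ 2 * m
parity-even zero          _ = 0 , refl
parity-even (suc (suc d)) e with parity-even d (trans (sym (parity-2+ d)) e)
... | m , refl = suc m , sym (*-suc 2 m)

TwoN⇒parity0 : ∀ {d} → TwoN d → parity d ≡ 0F
TwoN⇒parity0 (m , refl) = parity-double (suc m)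

parity0⇒TwoN : ∀ {d} → parity d ≡ 0F → 0 < d → TwoN d
parity0⇒TwoN {d} e pos with parity-even d e
... | suc m , d≡ = m , d≡
... | zero  , refl = contradiction pos (<-irrefl refl)

sameParity⇒evenDistance : ∀ u v → parity u ≡ parity v → u ≢ v → TwoN ∣ u - v ∣
sameParity⇒evenDistance zero    zero    _ u≢v = contradiction refl u≢v
sameParity⇒evenDistance zero    (suc v) e _   = parity0⇒TwoN (sym e) (s≤s z≤n)
sameParity⇒evenDistance (suc u) zero    e _   = parity0⇒TwoN e (s≤s z≤n)
sameParity⇒evenDistance (suc u) (suc v) e u≢v =
  sameParity⇒evenDistance u v (parity-suc-injective u v e) (u≢v ∘ cong suc)

sameParity⇒¬oddDistance : ∀ u v → parity u ≡ parity v → ¬ CoTwoN ∣ u - v ∣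
sameParity⇒¬oddDistance u v e (pos , ¬even) with u ≟ v
... | yes refl = <-irrefl (sym (m≡n⇒∣m-n∣≡0 {u} refl)) pos
... | no  u≢v  = ¬even (sameParity⇒evenDistance u v e u≢v)

distinctParity⇒oddDistance : ∀ u v → parity u ≢ parity v → CoTwoN ∣ u - v ∣
distinctParity⇒oddDistance zero    zero    ne = contradiction refl ne
distinctParity⇒oddDistance zero    (suc v) ne = s≤s z≤n , ne ∘ sym ∘ TwoN⇒parity0
distinctParity⇒oddDistance (suc u) zero    ne = s≤s z≤n , ne ∘ TwoN⇒parity0
distinctParity⇒oddDistance (suc u) (suc v) ne =
  distinctParity⇒oddDistance u v (ne ∘ cong opposite)

sameHalf⇒close : ∀ u v → ⌊ u /2⌋ ≡ ⌊ v /2⌋ → ∣ u - v ∣ < 2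
sameHalf⇒close 0             0             _  = s≤s z≤n
sameHalf⇒close 0             1             _  = s≤s (s≤s z≤n)
sameHalf⇒close 1             0             _  = s≤s (s≤s z≤n)
sameHalf⇒close 1             1             _  = s≤s z≤n
sameHalf⇒close 0             (suc (suc v)) ()
sameHalf⇒close 1             (suc (suc v)) ()
sameHalf⇒close (suc (suc u)) 0             ()
sameHalf⇒close (suc (suc u)) 1             ()
sameHalf⇒close (suc (suc u)) (suc (suc v)) e  = sameHalf⇒close u v (suc-injective e)

sameHalf⇒¬evenDistance : ∀ u v → ⌊ u /2⌋ ≡ ⌊ v /2⌋ → ¬ TwoN ∣ u - v ∣
sameHalf⇒¬evenDistance u v e (m , d≡) =
  <⇒≱ (sameHalf⇒close u v e) (subst (2 ≤_) (sym d≡) (m≤m*n 2 (suc m)))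

n≤1+2⌊n/2⌋ : ∀ n → n ≤ suc (⌊ n /2⌋ + ⌊ n /2⌋)
n≤1+2⌊n/2⌋ 0             = z≤n
n≤1+2⌊n/2⌋ 1             = s≤s z≤n
n≤1+2⌊n/2⌋ (suc (suc n)) =
  s≤s (s≤s (≤-trans (n≤1+2⌊n/2⌋ n) (≤-reflexive (sym (+-suc _ _)))))

-- Counting permutations: Permutation′ n has exactly n! elements up to ≈

encode : ∀ {n} → Permutation′ n → Fin (n !)
encode {zero}  π = 0F
encode {suc n} π = combine (π ⟨$⟩ʳ 0F) (encode (remove 0F π))

encode-injective : ∀ {n} (π ρ : Permutation′ n) → encode π ≡ encode ρ → π ≈ ρ
encode-injective {suc n} π ρ e 0F       = proj₁ (combine-injective (π ⟨$⟩ʳ 0F) _ (ρ ⟨$⟩ʳ 0F) _ e)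
encode-injective {suc n} π ρ e (F.suc j) = begin
  π ⟨$⟩ʳ F.suc j                                   ≡⟨ punchIn-permute π 0F j ⟩
  F.punchIn (π ⟨$⟩ʳ 0F) (remove 0F π ⟨$⟩ʳ j)       ≡⟨ cong₂ F.punchIn head≡ (encode-injective (remove 0F π) (remove 0F ρ) tail≡ j) ⟩
  F.punchIn (ρ ⟨$⟩ʳ 0F) (remove 0F ρ ⟨$⟩ʳ j)       ≡⟨ punchIn-permute ρ 0F j ⟨
  ρ ⟨$⟩ʳ F.suc j                                   ∎
  where
  open ≡-Reasoning
  heads-and-tails : π ⟨$⟩ʳ 0F ≡ ρ ⟨$⟩ʳ 0F × encode (remove 0F π) ≡ encode (remove 0F ρ)
  heads-and-tails = combine-injective (π ⟨$⟩ʳ 0F) (encode (remove 0F π)) (ρ ⟨$⟩ʳ 0F) (encode (remove 0F ρ)) e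
  head≡ : π ⟨$⟩ʳ 0F ≡ ρ ⟨$⟩ʳ 0F
  head≡ = proj₁ heads-and-tails
  tail≡ : encode (remove 0F π) ≡ encode (remove 0F ρ)
  tail≡ = proj₂ heads-and-tails

decode : ∀ {n} → Fin (n !) → Permutation′ n
decode {zero}  _ = id
decode {suc n} c = insert 0F (proj₁ q) (decode (proj₂ q))
  where
  q : Fin (suc n) × Fin (n !)
  q = remQuot {suc n} (n !) c

decode-injective : ∀ {n} (c d : Fin (n !)) → decode c ≈ decode d → c ≡ d
decode-injective {zero}  0F 0F _ = refl
decode-injective {suc n} c d e = begin
  c                                       ≡⟨ combine-remQuot {suc n} (n !) c ⟨
  combine (proj₁ qc) (proj₂ qc)           ≡⟨ cong₂ combine head≡ tail≡ ⟩
  combine (proj₁ qd) (proj₂ qd)           ≡⟨ combine-remQuot {suc n} (n !) d ⟩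
  d                                       ∎
  where
  open ≡-Reasoning
  qc qd : Fin (suc n) × Fin (n !)
  qc = remQuot {suc n} (n !) c
  qd = remQuot {suc n} (n !) d
  head≡ : proj₁ qc ≡ proj₁ qd
  head≡ = e 0F
  tail≡ : proj₂ qc ≡ proj₂ qd
  tail≡ = decode-injective {n} _ _ λ k → punchIn-injective (proj₁ qc) _ _ (begin
    F.punchIn (proj₁ qc) (decode (proj₂ qc) ⟨$⟩ʳ k)  ≡⟨ insert-punchIn 0F _ (decode (proj₂ qc)) k ⟨
    decode c ⟨$⟩ʳ F.suc k                              ≡⟨ e (F.suc k) ⟩
    decode d ⟨$⟩ʳ F.suc k                              ≡⟨ insert-punchIn 0F _ (decode (proj₂ qd)) k ⟩
    F.punchIn (proj₁ qd) (decode (proj₂ qd) ⟨$⟩ʳ k)  ≡⟨ cong (λ j → F.punchIn j (decode (proj₂ qd) ⟨$⟩ʳ k)) head≡ ⟨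
    F.punchIn (proj₁ qc) (decode (proj₂ qd) ⟨$⟩ʳ k)  ∎)

injective₂⇒≤ : ∀ {a m N} (f : Fin a → Fin m → Fin N) →
  (∀ {i x j y} → f i x ≡ f j y → i ≡ j × x ≡ y) → a * m ≤ N
injective₂⇒≤ {a} {m} f inj = injective⇒≤ {f = λ c → f (row c) (col c)} λ {c} {d} e →
  let (rows≡ , cols≡) = inj e in begin
    c                         ≡⟨ combine-remQuot {a} m c ⟨
    combine (row c) (col c)   ≡⟨ cong₂ combine rows≡ cols≡ ⟩
    combine (row d) (col d)   ≡⟨ combine-remQuot {a} m d ⟩
    d                         ∎
  where
  open ≡-Reasoning
  row : Fin (a * m) → Fin a
  row c = proj₁ (remQuot {a} m c)
  col : Fin (a * m) → Fin m
  col c = proj₂ (remQuot {a} m c)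

≉⇒differ : ∀ {n} (π ρ : Permutation′ n) → ¬ π ≈ ρ → ∃[ i ] π ⟨$⟩ʳ i ≢ ρ ⟨$⟩ʳ i
≉⇒differ {n} π ρ = ¬∀⟶∃¬ n _ (λ i → π ⟨$⟩ʳ i ≟F ρ ⟨$⟩ʳ i)

∘ₚ-cancelˡ : ∀ {n} (π σ τ : Permutation′ n) → π ∘ₚ σ ≈ π ∘ₚ τ → σ ≈ τ
∘ₚ-cancelˡ π σ τ e v = begin
  σ ⟨$⟩ʳ v                      ≡⟨ cong (σ ⟨$⟩ʳ_) (inverseʳ π) ⟨
  σ ⟨$⟩ʳ (π ⟨$⟩ʳ (π ⟨$⟩ˡ v))    ≡⟨ e (π ⟨$⟩ˡ v) ⟩
  τ ⟨$⟩ʳ (π ⟨$⟩ʳ (π ⟨$⟩ˡ v))    ≡⟨ cong (τ ⟨$⟩ʳ_) (inverseʳ π) ⟩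
  τ ⟨$⟩ʳ v                      ∎
  where open ≡-Reasoning

-- Pair swaps: the 2^⌊n/2⌋ permutations exchanging some values 2j ↔ 2j+1

HalfPreserving : ∀ {n} → Permutation′ n → Set
HalfPreserving σ = ∀ v → ⌊ toℕ (σ ⟨$⟩ʳ v) /2⌋ ≡ ⌊ toℕ v /2⌋

swapIf : ∀ {n} → Fin 2 → Permutation′ n → Permutation′ (2 + n)
swapIf 0F σ = lift₀ (lift₀ σ)
swapIf 1F σ = swap σ

pairSwaps : ∀ n → (Fin ⌊ n /2⌋ → Fin 2) → Permutation′ n
pairSwaps 0             _    = id
pairSwaps 1             _    = id
pairSwaps (suc (suc n)) bits = swapIf (bits 0F) (pairSwaps n (bits ∘ F.suc))

swapIf-halfPreserving : ∀ {n} x (σ : Permutation′ n) → HalfPreserving σ → HalfPreserving (swapIf x σ)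
swapIf-halfPreserving 0F σ h 0F                = refl
swapIf-halfPreserving 0F σ h 1F                = refl
swapIf-halfPreserving 0F σ h (F.suc (F.suc v)) = cong suc (h v)
swapIf-halfPreserving 1F σ h 0F                = refl
swapIf-halfPreserving 1F σ h 1F                = refl
swapIf-halfPreserving 1F σ h (F.suc (F.suc v)) = cong suc (h v)

pairSwaps-halfPreserving : ∀ n bits → HalfPreserving (pairSwaps n bits)
pairSwaps-halfPreserving 0             _    _ = refl
pairSwaps-halfPreserving 1             _    _ = refl
pairSwaps-halfPreserving (suc (suc n)) bits =
  swapIf-halfPreserving (bits 0F) _ (pairSwaps-halfPreserving n (bits ∘ F.suc))

swapIf-injective : ∀ {n} x y (σ τ : Permutation′ n) → swapIf x σ ≈ swapIf y τ → x ≡ y × σ ≈ τ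
swapIf-injective 0F 0F σ τ e = refl , λ v → Fin-suc-injective (Fin-suc-injective (e (F.suc (F.suc v))))
swapIf-injective 1F 1F σ τ e = refl , λ v → Fin-suc-injective (Fin-suc-injective (e (F.suc (F.suc v))))
swapIf-injective 0F 1F σ τ e with () ← e 0F
swapIf-injective 1F 0F σ τ e with () ← e 0F

pairSwaps-injective : ∀ n bits bits′ → pairSwaps n bits ≈ pairSwaps n bits′ → bits ≗ bits′
pairSwaps-injective (suc (suc n)) bits bits′ e 0F =
  proj₁ (swapIf-injective (bits 0F) (bits′ 0F) (pairSwaps n (bits ∘ F.suc)) (pairSwaps n (bits′ ∘ F.suc)) e)
pairSwaps-injective (suc (suc n)) bits bits′ e (F.suc j) =
  pairSwaps-injective n (bits ∘ F.suc) (bits′ ∘ F.suc)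
    (proj₂ (swapIf-injective (bits 0F) (bits′ 0F) (pairSwaps n (bits ∘ F.suc)) (pairSwaps n (bits′ ∘ F.suc)) e)) j

-- Parity classes of permutations

parityVector : ∀ {n} → Permutation′ n → Fin n → Fin 2
parityVector π i = parity (toℕ (π ⟨$⟩ʳ i))

parityCode : ∀ {n} → Permutation′ n → Fin (2 ^ n)
parityCode π = funToFin (parityVector π)

funToFin-cong : ∀ {m n} (f g : Fin m → Fin n) → f ≗ g → funToFin f ≡ funToFin g
funToFin-cong {zero}  f g _ = refl
funToFin-cong {suc m} f g e = cong₂ combine (e 0F) (funToFin-cong (f ∘ F.suc) (g ∘ F.suc) (e ∘ F.suc))

finToFun-injective : ∀ {m n} (x y : Fin (n ^ m)) → finToFun {n} {m} x ≗ finToFun y → x ≡ y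
finToFun-injective {m} {n} x y e = begin
  x                                     ≡⟨ funToFin-finToFin {m} {n} x ⟨
  funToFin (finToFun {n} {m} x)         ≡⟨ funToFin-cong (finToFun x) (finToFun y) e ⟩
  funToFin (finToFun {n} {m} y)         ≡⟨ funToFin-finToFin {m} {n} y ⟩
  y                                     ∎
  where open ≡-Reasoning

parityCode-sound : ∀ {n} (π ρ : Permutation′ n) → parityCode π ≡ parityCode ρ → parityVector π ≗ parityVector ρ
parityCode-sound π ρ e i = begin
  parityVector π i                      ≡⟨ finToFun-funToFin (parityVector π) i ⟨
  finToFun (parityCode π) i             ≡⟨ cong (λ c → finToFun c i) e ⟩
  finToFun (parityCode ρ) i             ≡⟨ finToFun-funToFin (parityVector ρ) i ⟩
  parityVector ρ i                      ∎
  where open ≡-Reasoning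

sameClass⇒TwoN-different : ∀ {n} (π ρ : Permutation′ n) →
  parityVector π ≗ parityVector ρ → ¬ π ≈ ρ → GDifferent TwoN π ρ
sameClass⇒TwoN-different π ρ same π≉ρ with ≉⇒differ π ρ π≉ρ
... | i , πi≢ρi =
  i , sameParity⇒evenDistance (toℕ (π ⟨$⟩ʳ i)) (toℕ (ρ ⟨$⟩ʳ i)) (same i) (πi≢ρi ∘ toℕ-injective)

differentClass⇒CoTwoN-different : ∀ {n} (π ρ : Permutation′ n) →
  ¬ parityVector π ≗ parityVector ρ → GDifferent CoTwoN π ρ
differentClass⇒CoTwoN-different {n} π ρ different
  with ¬∀⟶∃¬ n _ (λ i → parityVector π i ≟F parityVector ρ i) different
... | i , ne = i , distinctParity⇒oddDistance (toℕ (π ⟨$⟩ʳ i)) (toℕ (ρ ⟨$⟩ʳ i)) ne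

CoTwoN-different⇒differentClass : ∀ {n} (π ρ : Permutation′ n) →
  GDifferent CoTwoN π ρ → ¬ parityVector π ≗ parityVector ρ
CoTwoN-different⇒differentClass π ρ (i , odd) same =
  sameParity⇒¬oddDistance (toℕ (π ⟨$⟩ʳ i)) (toℕ (ρ ⟨$⟩ʳ i)) (same i) odd

TwoN-different⇒differentHalves : ∀ {n} (π ρ : Permutation′ n) → GDifferent TwoN π ρ →
  ¬ (∀ i → ⌊ toℕ (π ⟨$⟩ʳ i) /2⌋ ≡ ⌊ toℕ (ρ ⟨$⟩ʳ i) /2⌋)
TwoN-different⇒differentHalves π ρ (i , even) halves =
  sameHalf⇒¬evenDistance (toℕ (π ⟨$⟩ʳ i)) (toℕ (ρ ⟨$⟩ʳ i)) (halves i) even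

-- Members of a co-2ℕ-code lie in pairwise different parity classes: b ≤ 2ⁿ.
coTwoNCode-bound : ∀ {n b} → Code n CoTwoN b → b ≤ 2 ^ n
coTwoNCode-bound (code , different) = injective⇒≤ {f = parityCode ∘ code} λ {i} {j} e → distinct i j e
  where
  distinct : ∀ i j → parityCode (code i) ≡ parityCode (code j) → i ≡ j
  distinct i j e with i ≟F j
  ... | yes i≡j = i≡j
  ... | no  i≢j = contradiction (parityCode-sound (code i) (code j) e)
                    (CoTwoN-different⇒differentClass (code i) (code j) (different i j i≢j))

-- Composing the members of a 2ℕ-code with all pair swaps yields pairwise
-- distinct permutations: a * 2^⌊n/2⌋ ≤ n!.
twoNCode-bound : ∀ {n a} → Code n TwoN a → a * 2 ^ ⌊ n /2⌋ ≤ n !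
twoNCode-bound {n} (code , different) = injective₂⇒≤ (λ i x → encode (swapped i x)) λ {i} {x} {j} {y} e →
  separate i x j y (encode-injective (swapped i x) (swapped j y) e)
  where
  swapped : _ → Fin (2 ^ ⌊ n /2⌋) → Permutation′ n
  swapped i x = code i ∘ₚ pairSwaps n (finToFun x)
  separate : ∀ i x j y → swapped i x ≈ swapped j y → i ≡ j × x ≡ y
  separate i x j y e with i ≟F j
  ... | yes refl = refl , finToFun-injective x y
                            (pairSwaps-injective n (finToFun x) (finToFun y)
                              (∘ₚ-cancelˡ (code i) (pairSwaps n (finToFun x)) (pairSwaps n (finToFun y)) e))
  ... | no  i≢j  = contradiction halves (TwoN-different⇒differentHalves (code i) (code j) (different i j i≢j))
    where
    halves : ∀ p → ⌊ toℕ (code i ⟨$⟩ʳ p) /2⌋ ≡ ⌊ toℕ (code j ⟨$⟩ʳ p) /2⌋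
    halves p = begin
      ⌊ toℕ (code i ⟨$⟩ʳ p) /2⌋          ≡⟨ pairSwaps-halfPreserving n (finToFun x) _ ⟨
      ⌊ toℕ (swapped i x ⟨$⟩ʳ p) /2⌋     ≡⟨ cong (λ v → ⌊ toℕ v /2⌋) (e p) ⟩
      ⌊ toℕ (swapped j y ⟨$⟩ʳ p) /2⌋     ≡⟨ pairSwaps-halfPreserving n (finToFun y) _ ⟩
      ⌊ toℕ (code j ⟨$⟩ʳ p) /2⌋          ∎
      where open ≡-Reasoning

-- Fibres and transversals of a map on a list

AllPairs-lookup : ∀ {A : Set} {R : A → A → Set} {xs : List A} → Symmetric R → AllPairs R xs →
  ∀ {i j} → i ≢ j → R (lookup xs i) (lookup xs j)
AllPairs-lookup R-sym (_  ∷ _)   {0F}      {0F}      i≢j = contradiction refl i≢j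
AllPairs-lookup R-sym (px ∷ _)   {0F}      {F.suc j} _   = All.lookup px (∈-lookup j)
AllPairs-lookup R-sym (px ∷ _)   {F.suc i} {0F}      _   = R-sym (All.lookup px (∈-lookup i))
AllPairs-lookup R-sym (_  ∷ pxs) {F.suc i} {F.suc j} i≢j = AllPairs-lookup R-sym pxs (i≢j ∘ cong F.suc)

length-filter-split : ∀ {A : Set} {P : A → Set} (P? : ∀ x → Dec (P x)) xs →
  length (filter P? xs) + length (filter (¬? ∘ P?) xs) ≡ length xs
length-filter-split P? []       = refl
length-filter-split P? (x ∷ xs) with P? x
... | yes _ = cong suc (length-filter-split P? xs)
... | no  _ = trans (+-suc _ _) (cong suc (length-filter-split P? xs))

module FibreTransversal {A B : Set} (_≟B_ : DecidableEquality B) (g : A → B) where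

  record Fibre : Set where
    field
      members : List A
      unique  : Unique members
      level   : ∀ {y z} → y ∈ members → z ∈ members → g y ≡ g z

  open Fibre

  size : Fibre → ℕ
  size = length ∘ members

  longer : (F G : Fibre) → Σ Fibre λ H → size F ≤ size H × size G ≤ size H
  longer F G with size G ≤? size F
  ... | yes G≤F = F , ≤-refl , G≤F
  ... | no  G≰F = G , <⇒≤ (≰⇒> G≰F) , ≤-refl

  record Split (L : List A) : Set where
    field
      fibre                : Fibre
      transversal          : List A
      transversal⊆         : transversal ⊆ L
      transversal-distinct : AllPairs (λ y z → g y ≢ g z) transversal
      bound                : length L ≤ size fibre * length transversal

  -- Greedy construction: the fibre of the head, plus a recursive split of the
  -- entries outside it (recursion on the length of L, measured by fuel).
  split : ∀ fuel L → length L ≤ fuel → Unique L → Split L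
  split _ [] _ _ = record
    { fibre = record { members = [] ; unique = [] ; level = λ () }
    ; transversal = [] ; transversal⊆ = λ () ; transversal-distinct = [] ; bound = z≤n }
  split (suc fuel) (x ∷ xs) (s≤s len) (x∉xs ∷ unique-xs) = record
    { fibre = proj₁ best
    ; transversal = x ∷ transversal
    ; transversal⊆ = λ { (here refl) → here refl ; (there y∈) → there (proj₁ (outside y∈)) }
    ; transversal-distinct = All.tabulate (λ y∈ e → proj₂ (outside y∈) (sym e)) ∷ transversal-distinct
    ; bound = total-bound }
    where
    sameAsX? : ∀ y → Dec (g y ≡ g x)
    sameAsX? y = g y ≟B g x
    inside others : List A
    inside = filter sameAsX? xs
    others = filter (¬? ∘ sameAsX?) xs

    rest : Split others
    rest = split fuel others (≤-trans (length-filter _ xs) len) (Unique.filter⁺ _ unique-xs)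
    open Split rest

    outside : ∀ {y} → y ∈ transversal → y ∈ xs × g y ≢ g x
    outside = ∈-filter⁻ (¬? ∘ sameAsX?) {xs = xs} ∘ transversal⊆

    fibreOfX : Fibre
    fibreOfX = record
      { members = x ∷ inside
      ; unique  = AllProperties.filter⁺ sameAsX? x∉xs ∷ Unique.filter⁺ _ unique-xs
      ; level   = λ y∈ z∈ → trans (toX y∈) (sym (toX z∈)) }
      where
      toX : ∀ {y} → y ∈ x ∷ inside → g y ≡ g x
      toX (here refl) = refl
      toX (there y∈)  = proj₂ (∈-filter⁻ sameAsX? {xs = xs} y∈)

    best : Σ Fibre λ H → size fibreOfX ≤ size H × size fibre ≤ size H
    best = longer fibreOfX fibre
    m : ℕ
    m = size (proj₁ best)

    total-bound : suc (length xs) ≤ m * suc (length transversal)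
    total-bound = begin
      suc (length xs)                              ≡⟨ cong suc (length-filter-split sameAsX? xs) ⟨
      suc (length inside) + length others         ≤⟨ +-mono-≤ (proj₁ (proj₂ best))
                                                       (≤-trans bound (*-monoˡ-≤ _ (proj₂ (proj₂ best)))) ⟩
      m + m * length transversal                   ≡⟨ *-suc m _ ⟨
      m * suc (length transversal)                 ∎
      where open ≤-Reasoning

-- Split all n! permutations by parity class: a largest class is a 2ℕ-code,
-- one representative per class is a co-2ℕ-code.
parityClassification : ∀ n → ∃[ a ] ∃[ b ] (Code n TwoN a × Code n CoTwoN b × n ! ≤ a * b)
parityClassification n =
  size fibre , length transversal , (fibreCode , fibreDifferent) ,
  (transversalCode , transversalDifferent) , n!≤
  where
  open FibreTransversal _≟F_ (parityCode ∘ decode {n})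
  open Fibre

  open Split (split (n !) (allFin (n !)) (≤-reflexive (length-tabulate _)) (Unique.allFin⁺ (n !)))

  fibreCode : Fin (size fibre) → Permutation′ n
  fibreCode = decode ∘ lookup (members fibre)

  fibreDifferent : ∀ i j → i ≢ j → GDifferent TwoN (fibreCode i) (fibreCode j)
  fibreDifferent i j i≢j = sameClass⇒TwoN-different (fibreCode i) (fibreCode j)
    (parityCode-sound (fibreCode i) (fibreCode j) (level fibre (∈-lookup i) (∈-lookup j)))
    (AllPairs-lookup ≢-sym (unique fibre) i≢j ∘ decode-injective _ _)

  transversalCode : Fin (length transversal) → Permutation′ n
  transversalCode = decode ∘ lookup transversal

  transversalDifferent : ∀ i j → i ≢ j → GDifferent CoTwoN (transversalCode i) (transversalCode j)
  transversalDifferent i j i≢j = differentClass⇒CoTwoN-different (transversalCode i) (transversalCode j)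
    (AllPairs-lookup ≢-sym transversal-distinct i≢j
      ∘ funToFin-cong (parityVector (transversalCode i)) (parityVector (transversalCode j)))

  n!≤ : n ! ≤ size fibre * length transversal
  n!≤ = ≤-trans (≤-reflexive (sym (length-tabulate _))) bound

^-distribʳ-* : ∀ x y k → (x * y) ^ k ≡ x ^ k * y ^ k
^-distribʳ-* x y zero    = refl
^-distribʳ-* x y (suc k) = begin
  x * y * (x * y) ^ k          ≡⟨ cong (x * y *_) (^-distribʳ-* x y k) ⟩
  x * y * (x ^ k * y ^ k)      ≡⟨ solve 4 (λ x y p q → x :* y :* (p :* q) := x :* p :* (y :* q)) refl x y (x ^ k) (y ^ k) ⟩
  x * x ^ k * (y * y ^ k)      ∎
  where
  open ≡-Reasoning
  open +-*-Solver

power-transfer : ∀ x y h n K e → x * 2 ^ h ≤ y * 2 ^ n → n * K ≤ e + h * K → x ^ K ≤ y ^ K * 2 ^ e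
power-transfer x y h n K e base exponent = *-cancelʳ-≤ _ _ (2 ^ (h * K)) {{m^n≢0 2 (h * K)}} (begin
  x ^ K * 2 ^ (h * K)          ≡⟨ cong (x ^ K *_) (^-*-assoc 2 h K) ⟨
  x ^ K * (2 ^ h) ^ K          ≡⟨ ^-distribʳ-* x (2 ^ h) K ⟨
  (x * 2 ^ h) ^ K              ≤⟨ ^-monoˡ-≤ K base ⟩
  (y * 2 ^ n) ^ K              ≡⟨ ^-distribʳ-* y (2 ^ n) K ⟩
  y ^ K * (2 ^ n) ^ K          ≡⟨ cong (y ^ K *_) (^-*-assoc 2 n K) ⟩
  y ^ K * 2 ^ (n * K)          ≤⟨ *-monoʳ-≤ (y ^ K) (^-monoʳ-≤ 2 exponent) ⟩
  y ^ K * 2 ^ (e + h * K)      ≡⟨ cong (y ^ K *_) (^-distribˡ-+-* 2 e (h * K)) ⟩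
  y ^ K * (2 ^ e * 2 ^ (h * K)) ≡⟨ *-assoc (y ^ K) _ _ ⟨
  y ^ K * 2 ^ e * 2 ^ (h * K)  ∎)
  where open ≤-Reasoning

exponent-bound : ∀ n k h → k ≤ n → n ≤ suc (h + h) → n * (2 * k) ≤ n * (k + 2) + h * (2 * k)
exponent-bound n k h k≤n n≤2h+1 = begin
  n * (2 * k)                      ≡⟨ solve 2 (λ n k → n :* (con 2 :* k) := n :* k :+ n :* k) refl n k ⟩
  n * k + n * k                    ≤⟨ +-monoʳ-≤ (n * k) (*-monoˡ-≤ k n≤2h+1) ⟩
  n * k + suc (h + h) * k          ≡⟨ solve 3 (λ n k h → n :* k :+ (con 1 :+ (h :+ h)) :* k
                                                := n :* k :+ k :+ h :* (con 2 :* k)) refl n k h ⟩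
  n * k + k + h * (2 * k)          ≤⟨ +-monoˡ-≤ (h * (2 * k)) (+-monoʳ-≤ (n * k) (≤-trans k≤n (m≤m+n n (n + 0)))) ⟩
  n * k + 2 * n + h * (2 * k)      ≡⟨ cong (_+ h * (2 * k)) (solve 2 (λ n k → n :* k :+ con 2 :* n := n :* (k :+ con 2)) refl n k) ⟩
  n * (k + 2) + h * (2 * k)        ∎
  where
  open ≤-Reasoning
  open +-*-Solver

codes-product-bound : ∀ {n a b} → Code n TwoN a → Code n CoTwoN b → a * b * 2 ^ ⌊ n /2⌋ ≤ n ! * 2 ^ n
codes-product-bound {n} {a} {b} codeA codeB = begin
  a * b * 2 ^ ⌊ n /2⌋       ≡⟨ *-assoc a b _ ⟩
  a * (b * 2 ^ ⌊ n /2⌋)     ≡⟨ cong (a *_) (*-comm b _) ⟩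
  a * (2 ^ ⌊ n /2⌋ * b)     ≡⟨ *-assoc a _ b ⟨
  a * 2 ^ ⌊ n /2⌋ * b       ≤⟨ *-mono-≤ (twoNCode-bound codeA) (coTwoNCode-bound codeB) ⟩
  n ! * 2 ^ n               ∎
  where open ≤-Reasoning

corollary2 :
    (∀ k → 1 ≤ k → ∀ N → ∃[ n ] (N ≤ n × 1 ≤ n × ∃[ a ] ∃[ b ]
      (Code n TwoN a × Code n CoTwoN b × (n !) ^ k ≤ (a * b) ^ k * 2 ^ n)))
    ×
    (∀ k → 1 ≤ k → ∃[ N ] ∀ n → N ≤ n → ∀ a b →
      Code n TwoN a → Code n CoTwoN b →
      (a * b) ^ (2 * k) ≤ (n !) ^ (2 * k) * 2 ^ (n * (k + 2)))
corollary2 =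
  -- Lower bound at n = N + 1: n! ≤ a·b, and the factor 2ⁿ only helps.
  (λ k _ N →
    let (a , b , codeA , codeB , n!≤ab) = parityClassification (suc N) in
    suc N , n≤1+n N , s≤s z≤n , a , b , codeA , codeB ,
    ≤-trans (^-monoˡ-≤ k n!≤ab) (m≤m*n _ (2 ^ suc N) {{m^n≢0 2 (suc N)}}))
  ,
  -- Upper bound from n = k on: raise a·b·2^⌊n/2⌋ ≤ n!·2ⁿ to the power 2k.
  (λ k _ → k , λ n k≤n a b codeA codeB →
    power-transfer (a * b) (n !) ⌊ n /2⌋ n (2 * k) (n * (k + 2))
      (codes-product-bound codeA codeB)
      (exponent-bound n k ⌊ n /2⌋ k≤n (n≤1+2⌊n/2⌋ n)))
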